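{- Let $p$ be an odd prime and let $e=\#\mathcal{E}^*$. If $4e+8<\frac{p-1}{2}$, then there exists a pair $(\alpha,\beta)\in(\mathbb{Z}/(p-1)\mathbb{Z})^2$ with $\alpha+\beta$ odd such that: (a) $(\alpha,\beta)$ is not a solution $(x,y)$ of any of the equations $2x=\pm\epsilon$, $2y=\pm\epsilon$ for $\epsilon\in\bar{\mathcal{E}}$; (b) $(\alpha,\beta)$ is not a solution of any of the equations $y=\pm x\pm\epsilon$ for $\epsilon\in\bar{\mathcal{E}}$, all equations taken in $\mathbb{Z}/(p-1)\mathbb{Z}$.
   Context: $\bar\chi$ is the mod-$p$ cyclotomic character. Let $\mathcal{C}$ be the class group of $\mathbb{Q}(\mu_p)$ tensored with $\mathbb{F}_p$, with the natural action of $\operatorname{Gal}(\mathbb{Q}(\mu_p)/\mathbb{Q})$, and for $i\in\mathbb{Z}/(p-1)\mathbb{Z}$ let $\mathcal{C}(\bar\chi^i)=\{x\in\mathcal{C}:g\cdot x=\bar\chi^i(g)x\ \forall g\}$. Let $\mathcal{E}=\{\epsilon\in\mathbb{Z}/(p-1)\mathbb{Z}:\mathcal{C}(\bar\chi^\epsilon)\neq0\}$, $\mathcal{E}^*=\{p-\epsilon\in\mathbb{Z}/(p-1)\mathbb{Z}:\epsilon\in\mathcal{E}\}\setminus\{0,\tfrac{p-1}{2}\}$, and $\bar{\mathcal{E}}=\mathcal{E}^*\cup\{0,1,\tfrac{p-1}{2}\}$. -}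

module Defs where

open import Data.Nat using (ℕ; zero; suc; _+_; _*_; _∸_; _/_)
open import Data.Nat.DivMod using (_mod_)
open import Data.Fin using (Fin; toℕ; _≟_)
open import Data.Fin.Properties using (any?)
open import Data.Fin.Subset using (Subset; _∈_; ∣_∣)
open import Data.Fin.Subset.Properties using (_∈?_)
open import Data.Bool using (Bool; _∧_; not)
open import Data.Vec using (tabulate)
open import Relation.Nullary using (does)
open import Relation.Nullary.Decidable using (_×-dec_)
open import Relation.Binary.PropositionalEquality using (_≡_)
open import Data.Sum using (_⊎_)

-- For an odd prime p we have p ≥ 3, so p - 1 = suc (p ∸ 2).
-- We write N p = suc (p ∸ 2) (= p - 1) and model ℤ/(p-1)ℤ as Fin (N p),
-- with arithmetic computed on representatives modulo N p.
N : ℕ → ℕ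
N p = suc (p ∸ 2)

ZN : ℕ → Set
ZN p = Fin (N p)

red : ∀ {p} → ℕ → ZN p
red {p} m = m mod (N p)

addZ : ∀ {p} → ZN p → ZN p → ZN p
addZ {p} x y = red {p} (toℕ x + toℕ y)

negZ : ∀ {p} → ZN p → ZN p
negZ {p} x = red {p} (N p ∸ toℕ x)

subZ : ∀ {p} → ZN p → ZN p → ZN p
subZ {p} x y = addZ {p} x (negZ {p} y)

dblZ : ∀ {p} → ZN p → ZN p
dblZ {p} x = red {p} (2 * toℕ x)

zeroZ oneZ halfZ : ∀ {p} → ZN p
zeroZ {p} = red {p} (0)
oneZ {p} = red {p} (1)
halfZ {p} = red {p} ((p ∸ 1) / 2)

-- the class of p - ε  (p - ε ≡ p + ((p-1) - ε) mod p-1)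
pMinus : ∀ {p} → ZN p → ZN p
pMinus {p} ε = red {p} (p + (N p ∸ toℕ ε))

Estar : ∀ {p} → Subset (N p) → Subset (N p)
Estar {p} ℰ = tabulate λ x →
  does (any? (λ ε → (ε ∈? ℰ) ×-dec (x ≟ pMinus {p} ε)))
  ∧ not (does (x ≟ zeroZ {p}))
  ∧ not (does (x ≟ halfZ {p}))

InEbar : ∀ {p} → Subset (N p) → ZN p → Set
InEbar {p} ℰ ε = ε ∈ Estar {p} ℰ ⊎ ε ≡ zeroZ {p} ⊎ ε ≡ oneZ {p} ⊎ ε ≡ halfZ {p}

{-# OPTIONS --safe #-}
-- Write p - 1 = 2h.  Since the modulus is even, the parity of a residue is well
-- defined, negation preserves it and addition adds it.  Every ε in ℰ̄ forbids at
-- most four values of α (the solutions of 2x = ±ε), and #ℰ̄ ≤ e + 3 gives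
-- 4(e + 3) < 2h, so a suitable α exists.  Now take β of parity opposite to α;
-- there are h such residues.  For odd ε the equations 2β = ±ε have no solution
-- (2β is even), and for even ε the equations β = ±α ± ε have none (they force β
-- to have the parity of α).  So each ε forbids at most four values of β, and the
-- self-inverse ε = 0 and ε = h forbid only two, leaving at most 4e + 8 < h.
module Submission where

open import Defs
open import Data.Nat using (ℕ; zero; suc; _+_; _*_; _<_; _≤_; _/_; _%_; _∸_; _<?_; z≤n; s≤s; NonZero; >-nonZero)
open import Data.Nat.Properties using (+-identityʳ; +-suc; *-zeroʳ; *-suc; *-comm; m∸n+n≡m; m+n∸n≡m; m<n+o⇒m∸n<o; ≮⇒≥; <⇒≤; ≤-trans; n<1+n; m<m+n; m≤m+n; m≤n+m; +-monoˡ-<; +-monoʳ-≤; *-monoʳ-≤; +-cancelʳ-≡; *-cancelˡ-≡; m*n≢0; module ≤-Reasoning)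
open import Data.Nat.DivMod using (m≡m%n+[m/n]*n; m*n/n≡m; m<n⇒m%n≡m; m≤n⇒[n∸m]%m≡n%m; %-congʳ; m%n*o≡m*o%[n*o]; n%n≡0)
open import Data.Nat.Primality using (Prime)
open import Data.Nat.Divisibility using (_∣_; divides)
open import Data.Nat.Tactic.RingSolver using (solve-∀)
open import Data.Bool using (Bool; true; false; not; _xor_; if_then_else_)
open import Data.Bool.Properties using (not-distribˡ-xor; xor-same; xor-assoc; xor-identityʳ; xor-inverseʳ; not-involutive; not-¬)
open import Data.Fin using (Fin; toℕ; fromℕ<; _≟_)
open import Data.Fin.Properties using (toℕ-injective; toℕ-fromℕ<; toℕ<n; all?; ¬∀⟶∃¬; pigeonhole) renaming (<⇒≢ to <⇒≢ᶠ)
open import Data.Fin.Subset using (Subset; ∣_∣) renaming (_∈_ to _∈ₛ_)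
open import Data.Vec using ([]; _∷_; here; there)
open import Data.List using (List; []; _∷_; _++_; length; map; concatMap; lookup)
open import Data.List.Properties using (length-++; length-map)
open import Data.List.Relation.Unary.Any using (here; there; index)
open import Data.List.Relation.Unary.Any.Properties using (lookup-index)
open import Data.List.Membership.Propositional using (_∈_; _∉_)
open import Data.List.Membership.Propositional.Properties using (∈-++⁺ˡ; ∈-++⁺ʳ; ∈-map⁺; ∈-concat⁺′)
open import Data.Product using (Σ; ∃; _×_; _,_)
open import Data.Sum using (_⊎_; inj₁; inj₂)
open import Data.Empty using (⊥-elim)
open import Function using (id)
open import Function.Definitions using (Injective)
open import Relation.Nullary using (¬_; yes; no; contradiction)
open import Relation.Binary.Definitions using (DecidableEquality)
open import Relation.Binary.PropositionalEquality using (_≡_; _≢_; refl; sym; trans; cong; cong₂; subst; subst₂; module ≡-Reasoning)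

double≡*2 : ∀ h → h + h ≡ h * 2
double≡*2 = solve-∀

double/2 : ∀ h → (h + h) / 2 ≡ h
double/2 h = trans (cong (_/ 2) (double≡*2 h)) (m*n/n≡m h 2)

suc≡h+h⇒0<h : ∀ {k h} → suc k ≡ h + h → 0 < h
suc≡h+h⇒0<h {h = suc _} _ = s≤s z≤n

%-below-double : ∀ {m h} .{{_ : NonZero h}} → m < h + h → m % h ≡ m ⊎ m % h + h ≡ m
%-below-double {m} {h} m<h+h with m <? h
... | yes m<h = inj₁ (m<n⇒m%n≡m m<h)
... | no m≮h = inj₂ (begin
  m % h + h     ≡⟨ cong (_+ h) m%h≡m∸h ⟩
  m ∸ h + h     ≡⟨ m∸n+n≡m h≤m ⟩
  m             ∎)
  where
  open ≡-Reasoning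
  h≤m : h ≤ m
  h≤m = ≮⇒≥ m≮h
  m%h≡m∸h : m % h ≡ m ∸ h
  m%h≡m∸h = trans (sym (m≤n⇒[n∸m]%m≡n%m h≤m)) (m<n⇒m%n≡m (m<n+o⇒m∸n<o m h m<h+h))

4[e+3]<h+h : ∀ {e h} → 4 * e + 8 < h → 4 * (e + 3) < h + h
4[e+3]<h+h {e} {h} bound = begin-strict
  4 * (e + 3)       ≡⟨ expand e ⟩
  (4 * e + 8) + 4   <⟨ +-monoˡ-< 4 bound ⟩
  h + 4             ≤⟨ +-monoʳ-≤ h 4≤h ⟩
  h + h             ∎
  where
  open ≤-Reasoning
  expand : ∀ e → 4 * (e + 3) ≡ (4 * e + 8) + 4
  expand = solve-∀
  4≤h : 4 ≤ h
  4≤h = ≤-trans (m≤m+n 4 4) (≤-trans (m≤n+m 8 (4 * e)) (<⇒≤ bound))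

parity : ℕ → Bool
parity zero    = false
parity (suc m) = not (parity m)

parity-+ : ∀ m n → parity (m + n) ≡ parity m xor parity n
parity-+ zero    n = refl
parity-+ (suc m) n = trans (cong not (parity-+ m n)) (not-distribˡ-xor (parity m) (parity n))

parity-double : ∀ m → parity (m + m) ≡ false
parity-double m = trans (parity-+ m m) (xor-same (parity m))

parity-2* : ∀ m → parity (2 * m) ≡ false
parity-2* m = trans (cong (λ n → parity (m + n)) (+-identityʳ m)) (parity-double m)

parity-*-even : ∀ m {n} → parity n ≡ false → parity (m * n) ≡ false
parity-*-even zero    n-even = refl
parity-*-even (suc m) {n} n-even = begin
  parity (n + m * n)             ≡⟨ parity-+ n (m * n) ⟩
  parity n xor parity (m * n)    ≡⟨ cong₂ _xor_ n-even (parity-*-even m n-even) ⟩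
  false                          ∎
  where open ≡-Reasoning

parity-∸ : ∀ {m n} → n ≤ m → parity (m ∸ n) ≡ parity m xor parity n
parity-∸ {m} {n} n≤m = begin
  parity (m ∸ n)                                ≡⟨ xor-identityʳ _ ⟨
  parity (m ∸ n) xor false                      ≡⟨ cong (parity (m ∸ n) xor_) (xor-same (parity n)) ⟨
  parity (m ∸ n) xor (parity n xor parity n)    ≡⟨ xor-assoc (parity (m ∸ n)) (parity n) (parity n) ⟨
  (parity (m ∸ n) xor parity n) xor parity n    ≡⟨ cong (_xor parity n) (parity-+ (m ∸ n) n) ⟨
  parity (m ∸ n + n) xor parity n               ≡⟨ cong (λ k → parity k xor parity n) (m∸n+n≡m n≤m) ⟩
  parity m xor parity n                         ∎
  where open ≡-Reasoning

parity-%-even : ∀ m n .{{_ : NonZero n}} → parity n ≡ false → parity (m % n) ≡ parity m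
parity-%-even m n n-even = begin
  parity (m % n)                           ≡⟨ xor-identityʳ _ ⟨
  parity (m % n) xor false                 ≡⟨ cong (parity (m % n) xor_) (parity-*-even (m / n) n-even) ⟨
  parity (m % n) xor parity (m / n * n)    ≡⟨ parity-+ (m % n) (m / n * n) ⟨
  parity (m % n + m / n * n)               ≡⟨ cong parity (m≡m%n+[m/n]*n m n) ⟨
  parity m                                 ∎
  where open ≡-Reasoning

parity≡false⇒double : ∀ m → parity m ≡ false → ∃ λ h → m ≡ h + h
parity≡false⇒double zero          _      = 0 , refl
parity≡false⇒double (suc zero)    ()
parity≡false⇒double (suc (suc m)) m-even
  with parity≡false⇒double m (trans (sym (not-involutive (parity m))) m-even)
... | h , refl = suc h , cong suc (sym (+-suc h h))

parity≡true⇒∤ : ∀ {m} → parity m ≡ true → ¬ 2 ∣ m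
parity≡true⇒∤ m-odd (divides q refl) = contradiction (trans (sym (parity-*-even q refl)) m-odd) λ ()

∤suc⇒double : ∀ m → ¬ 2 ∣ suc m → ∃ λ h → m ≡ h + h
∤suc⇒double m 2∤1+m with parity m in m-parity
... | false = parity≡false⇒double m m-parity
... | true with parity≡false⇒double (suc m) (cong not m-parity)
...   | h , 1+m≡h+h = ⊥-elim (2∤1+m (divides h (trans 1+m≡h+h (double≡*2 h))))

bit : Bool → ℕ
bit false = 0
bit true  = 1

parity-bit : ∀ b → parity (bit b) ≡ b
parity-bit false = refl
parity-bit true  = refl

2*m+bit<n+n : ∀ {m n} b → m < n → 2 * m + bit b < n + n
2*m+bit<n+n {m} {n} b m<n = begin-strict
  2 * m + bit b   ≤⟨ +-monoʳ-≤ (2 * m) (bit≤1 b) ⟩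
  2 * m + 1       <⟨ n<1+n _ ⟩
  suc (2 * m + 1) ≡⟨ regroup m ⟩
  2 * suc m       ≤⟨ *-monoʳ-≤ 2 m<n ⟩
  2 * n           ≡⟨ cong (n +_) (+-identityʳ n) ⟩
  n + n           ∎
  where
  open ≤-Reasoning
  bit≤1 : ∀ b → bit b ≤ 1
  bit≤1 false = z≤n
  bit≤1 true  = s≤s z≤n
  regroup : ∀ m → suc (2 * m + 1) ≡ 2 * suc m
  regroup = solve-∀

module _ {n h : ℕ} (n≡h+h : n ≡ h + h) (b : Bool) where

  ofParity : Fin h → Fin n
  ofParity i = fromℕ< (subst (2 * toℕ i + bit b <_) (sym n≡h+h) (2*m+bit<n+n b (toℕ<n i)))

  toℕ-ofParity : ∀ i → toℕ (ofParity i) ≡ 2 * toℕ i + bit b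
  toℕ-ofParity i = toℕ-fromℕ< _

  ofParity-injective : Injective _≡_ _≡_ ofParity
  ofParity-injective {i} {j} eq = toℕ-injective (*-cancelˡ-≡ (toℕ i) (toℕ j) 2
    (+-cancelʳ-≡ (bit b) (2 * toℕ i) (2 * toℕ j)
      (trans (sym (toℕ-ofParity i)) (trans (cong toℕ eq) (toℕ-ofParity j)))))

  parity-ofParity : ∀ i → parity (toℕ (ofParity i)) ≡ b
  parity-ofParity i = begin
    parity (toℕ (ofParity i))                 ≡⟨ cong parity (toℕ-ofParity i) ⟩
    parity (2 * toℕ i + bit b)                ≡⟨ parity-+ (2 * toℕ i) (bit b) ⟩
    parity (2 * toℕ i) xor parity (bit b)     ≡⟨ cong₂ _xor_ (parity-2* (toℕ i)) (parity-bit b) ⟩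
    b                                         ∎
    where open ≡-Reasoning

elements : ∀ {m} → Subset m → List (Fin m)
elements []          = []
elements (true  ∷ S) = Fin.zero ∷ map Fin.suc (elements S)
elements (false ∷ S) = map Fin.suc (elements S)

length-elements : ∀ {m} (S : Subset m) → length (elements S) ≡ ∣ S ∣
length-elements []          = refl
length-elements (true  ∷ S) = cong suc (trans (length-map Fin.suc (elements S)) (length-elements S))
length-elements (false ∷ S) = trans (length-map Fin.suc (elements S)) (length-elements S)

∈ₛ⇒∈-elements : ∀ {m} {S : Subset m} {x} → x ∈ₛ S → x ∈ elements S
∈ₛ⇒∈-elements {S = true  ∷ S} here        = here refl
∈ₛ⇒∈-elements {S = true  ∷ S} (there x∈S) = there (∈-map⁺ Fin.suc (∈ₛ⇒∈-elements x∈S))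
∈ₛ⇒∈-elements {S = false ∷ S} (there x∈S) = ∈-map⁺ Fin.suc (∈ₛ⇒∈-elements x∈S)

∈-concatMap⁺ : ∀ {A B : Set} (f : A → List B) {x y ys} → y ∈ f x → x ∈ ys → y ∈ concatMap f ys
∈-concatMap⁺ f y∈fx x∈ys = ∈-concat⁺′ y∈fx (∈-map⁺ f x∈ys)

length-concatMap-const : ∀ {A B : Set} (f : A → List B) {c} → (∀ x → length (f x) ≡ c) →
                         ∀ xs → length (concatMap f xs) ≡ c * length xs
length-concatMap-const f {c} f-length []       = sym (*-zeroʳ c)
length-concatMap-const f {c} f-length (x ∷ xs) = begin
  length (f x ++ concatMap f xs)             ≡⟨ length-++ (f x) ⟩
  length (f x) + length (concatMap f xs)     ≡⟨ cong₂ _+_ (f-length x) (length-concatMap-const f f-length xs) ⟩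
  c + c * length xs                          ≡⟨ *-suc c (length xs) ⟨
  c * length (x ∷ xs)                        ∎
  where open ≡-Reasoning

module _ {A : Set} (_≟ᴬ_ : DecidableEquality A) where
  open import Data.List.Membership.DecPropositional _≟ᴬ_ using (_∈?_)

  injection-avoids : ∀ {m} (f : Fin m → A) → Injective _≡_ _≡_ f →
                     (D : List A) → length D < m → ∃ λ i → f i ∉ D
  injection-avoids {m} f f-injective D |D|<m with all? (λ i → f i ∈? D)
  ... | no ¬all∈ = ¬∀⟶∃¬ m _ (λ i → f i ∈? D) ¬all∈
  ... | yes all∈ with pigeonhole |D|<m (λ i → index (all∈ i))
  ...   | i , j , i<j , same-index = contradiction (f-injective (begin
    f i                      ≡⟨ lookup-index (all∈ i) ⟩
    lookup D (index (all∈ i)) ≡⟨ cong (lookup D) same-index ⟩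
    lookup D (index (all∈ j)) ≡⟨ lookup-index (all∈ j) ⟨
    f j                      ∎)) (<⇒≢ᶠ i<j)
    where open ≡-Reasoning

-- ℤ/(p - 1)ℤ with p = k + 2, so that ZN p is Fin (suc k) definitionally, and p - 1 = 2h.

module EvenModulus (k h : ℕ) (1+k≡h+h : suc k ≡ h + h) where

  p n : ℕ
  p = suc (suc k)
  n = suc k

  Z : Set
  Z = ZN p

  [_] : ℕ → Z
  [ m ] = red {p} m

  add sub : Z → Z → Z
  add = addZ {p}
  sub = subZ {p}

  neg dbl : Z → Z
  neg = negZ {p}
  dbl = dblZ {p}

  0<h : 0 < h
  0<h = suc≡h+h⇒0<h 1+k≡h+h

  instance
    h-nonZero : NonZero h
    h-nonZero = >-nonZero 0<h

  h<n : h < n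
  h<n = subst (h <_) (sym 1+k≡h+h) (m<m+n h 0<h)

  toℕ-red : ∀ m → toℕ [ m ] ≡ m % n
  toℕ-red m = toℕ-fromℕ< _

  toℕ-red-< : ∀ {m} → m < n → toℕ [ m ] ≡ m
  toℕ-red-< {m} m<n = trans (toℕ-red m) (m<n⇒m%n≡m m<n)

  red-toℕ : ∀ x → [ toℕ x ] ≡ x
  red-toℕ x = toℕ-injective (toℕ-red-< (toℕ<n x))

  parityᶻ : Z → Bool
  parityᶻ x = parity (toℕ x)

  parity-red : ∀ m → parityᶻ [ m ] ≡ parity m
  parity-red m = trans (cong parity (toℕ-red m))
                       (parity-%-even m n (trans (cong parity 1+k≡h+h) (parity-double h)))

  parity-neg : ∀ x → parityᶻ (neg x) ≡ parityᶻ x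
  parity-neg x = begin
    parityᶻ (neg x)                ≡⟨ parity-red (n ∸ toℕ x) ⟩
    parity (n ∸ toℕ x)             ≡⟨ parity-∸ (<⇒≤ (toℕ<n x)) ⟩
    parity n xor parityᶻ x         ≡⟨ cong (λ m → parity m xor parityᶻ x) 1+k≡h+h ⟩
    parity (h + h) xor parityᶻ x   ≡⟨ cong (_xor parityᶻ x) (parity-double h) ⟩
    parityᶻ x                      ∎
    where open ≡-Reasoning

  parity-add : ∀ x y → parityᶻ (add x y) ≡ parityᶻ x xor parityᶻ y
  parity-add x y = trans (parity-red (toℕ x + toℕ y)) (parity-+ (toℕ x) (toℕ y))

  parity-dbl : ∀ x → parityᶻ (dbl x) ≡ false
  parity-dbl x = trans (parity-red (2 * toℕ x)) (parity-2* (toℕ x))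

  ±_ : Z → List Z
  ± ε = ε ∷ neg ε ∷ []

  shifts : Z → Z → List Z
  shifts α ε = add α ε ∷ sub α ε ∷ add (neg α) ε ∷ sub (neg α) ε ∷ []

  parity-∈± : ∀ {ε y} → y ∈ ± ε → parityᶻ y ≡ parityᶻ ε
  parity-∈±         (here refl)         = refl
  parity-∈± {ε = ε} (there (here refl)) = parity-neg ε

  parity-∈shifts : ∀ α ε {y} → y ∈ shifts α ε → parityᶻ y ≡ parityᶻ α xor parityᶻ ε
  parity-∈shifts α ε (here refl) = parity-add α ε
  parity-∈shifts α ε (there (here refl)) =
    trans (parity-add α (neg ε)) (cong (parityᶻ α xor_) (parity-neg ε))
  parity-∈shifts α ε (there (there (here refl))) =
    trans (parity-add (neg α) ε) (cong (_xor parityᶻ ε) (parity-neg α))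
  parity-∈shifts α ε (there (there (there (here refl)))) =
    trans (parity-add (neg α) (neg ε)) (cong₂ _xor_ (parity-neg α) (parity-neg ε))

  odd⇒dbl∉± : ∀ {ε} x → parityᶻ ε ≡ true → dbl x ∉ ± ε
  odd⇒dbl∉± x ε-odd 2x∈±ε = contradiction (trans (sym (parity-dbl x)) (trans (parity-∈± 2x∈±ε) ε-odd)) λ ()

  even⇒∉shifts : ∀ {α β ε} → parityᶻ β ≡ not (parityᶻ α) → parityᶻ ε ≡ false → β ∉ shifts α ε
  even⇒∉shifts {α} {β} {ε} β-opposite ε-even β∈shifts = not-¬ β-same β-opposite
    where
    open ≡-Reasoning
    β-same : parityᶻ β ≡ parityᶻ α
    β-same = begin
      parityᶻ β                ≡⟨ parity-∈shifts α ε β∈shifts ⟩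
      parityᶻ α xor parityᶻ ε  ≡⟨ cong (parityᶻ α xor_) ε-even ⟩
      parityᶻ α xor false      ≡⟨ xor-identityʳ (parityᶻ α) ⟩
      parityᶻ α                ∎

  halves : Z → List Z
  halves c = [ toℕ c / 2 ] ∷ [ toℕ c / 2 + h ] ∷ []

  toℕ-dbl/2 : ∀ x → toℕ (dbl x) / 2 ≡ toℕ x % h
  toℕ-dbl/2 x = begin
    toℕ (dbl x) / 2                ≡⟨ cong (_/ 2) (toℕ-red (2 * toℕ x)) ⟩
    2 * toℕ x % n / 2              ≡⟨ cong (λ m → m % n / 2) (*-comm 2 (toℕ x)) ⟩
    toℕ x * 2 % n / 2              ≡⟨ cong (_/ 2) (%-congʳ (trans 1+k≡h+h (double≡*2 h))) ⟩
    toℕ x * 2 % (h * 2) / 2        ≡⟨ cong (_/ 2) (m%n*o≡m*o%[n*o] (toℕ x) h 2) ⟨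
    toℕ x % h * 2 / 2              ≡⟨ m*n/n≡m (toℕ x % h) 2 ⟩
    toℕ x % h                      ∎
    where
    open ≡-Reasoning
    instance _ = m*n≢0 h 2

  dbl≡⇒∈halves : ∀ {x c} → dbl x ≡ c → x ∈ halves c
  dbl≡⇒∈halves {x} refl with %-below-double (subst (toℕ x <_) 1+k≡h+h (toℕ<n x))
  ... | inj₁ x%h≡x   = here (sym (trans (cong [_] (trans (toℕ-dbl/2 x) x%h≡x)) (red-toℕ x)))
  ... | inj₂ x%h+h≡x =
    there (here (sym (trans (cong (λ m → [ m + h ]) (toℕ-dbl/2 x)) (trans (cong [_] x%h+h≡x) (red-toℕ x)))))

  roots : Z → List Z
  roots ε = halves ε ++ halves (neg ε)

  ∉roots⇒dbl∉± : ∀ {x ε} → x ∉ roots ε → dbl x ∉ ± ε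
  ∉roots⇒dbl∉±         x∉ (here 2x≡ε)          = x∉ (∈-++⁺ˡ (dbl≡⇒∈halves 2x≡ε))
  ∉roots⇒dbl∉± {ε = ε} x∉ (there (here 2x≡-ε)) = x∉ (∈-++⁺ʳ (halves ε) (dbl≡⇒∈halves 2x≡-ε))

  ∉halves⇒dbl∉± : ∀ {x ε} → neg ε ≡ ε → x ∉ halves ε → dbl x ∉ ± ε
  ∉halves⇒dbl∉± ε-self x∉ (here 2x≡ε)          = x∉ (dbl≡⇒∈halves 2x≡ε)
  ∉halves⇒dbl∉± ε-self x∉ (there (here 2x≡-ε)) = x∉ (dbl≡⇒∈halves (trans 2x≡-ε ε-self))

  -- The values a single ε forbids for β once β has parity opposite to α: by parity only
  -- the shifts matter for odd ε, and only the roots for even ε.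

  obstructions : Z → Z → List Z
  obstructions α ε = if parityᶻ ε then shifts α ε else roots ε

  length-obstructions : ∀ α ε → length (obstructions α ε) ≡ 4
  length-obstructions α ε with parityᶻ ε
  ... | true  = refl
  ... | false = refl

  ∉obstructions : ∀ {α β} ε → parityᶻ β ≡ not (parityᶻ α) →
                  β ∉ obstructions α ε → dbl β ∉ ± ε × β ∉ shifts α ε
  ∉obstructions {α} {β} ε β-opposite β∉ with parityᶻ ε in ε-parity
  ... | true  = odd⇒dbl∉± β ε-parity , β∉
  ... | false = ∉roots⇒dbl∉± β∉ , even⇒∉shifts {α} {β} {ε} β-opposite ε-parity

  selfInverseObstructions : Z → Z → List Z
  selfInverseObstructions α ε = if parityᶻ ε then add α ε ∷ add (neg α) ε ∷ [] else halves ε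

  length-selfInverseObstructions : ∀ α ε → length (selfInverseObstructions α ε) ≡ 2
  length-selfInverseObstructions α ε with parityᶻ ε
  ... | true  = refl
  ... | false = refl

  ∉selfInverseObstructions : ∀ {α β ε} → neg ε ≡ ε → parityᶻ β ≡ not (parityᶻ α) →
                             β ∉ selfInverseObstructions α ε → dbl β ∉ ± ε × β ∉ shifts α ε
  ∉selfInverseObstructions {α} {β} {ε} ε-self β-opposite β∉ with parityᶻ ε in ε-parity
  ... | true  = odd⇒dbl∉± β ε-parity , β∉shifts
    where
    β∉shifts : β ∉ shifts α ε
    β∉shifts (here e)                         = β∉ (here e)
    β∉shifts (there (here e))                 = β∉ (here (trans e (cong (add α) ε-self)))
    β∉shifts (there (there (here e)))         = β∉ (there (here e))
    β∉shifts (there (there (there (here e)))) = β∉ (there (here (trans e (cong (add (neg α)) ε-self))))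
  ... | false = ∉halves⇒dbl∉± ε-self β∉ , even⇒∉shifts {α} {β} {ε} β-opposite ε-parity

  neg-zeroZ : neg (zeroZ {p}) ≡ zeroZ {p}
  neg-zeroZ = toℕ-injective (trans (toℕ-red n) (n%n≡0 n))

  toℕ-halfZ : toℕ (halfZ {p}) ≡ h
  toℕ-halfZ = trans (cong (λ m → toℕ [ m / 2 ]) 1+k≡h+h)
                    (trans (cong (λ m → toℕ [ m ]) (double/2 h)) (toℕ-red-< h<n))

  neg-halfZ : neg (halfZ {p}) ≡ halfZ {p}
  neg-halfZ = toℕ-injective (begin
    toℕ [ n ∸ toℕ (halfZ {p}) ]   ≡⟨ cong (λ m → toℕ [ n ∸ m ]) toℕ-halfZ ⟩
    toℕ [ n ∸ h ]                 ≡⟨ cong (λ m → toℕ [ m ∸ h ]) 1+k≡h+h ⟩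
    toℕ [ h + h ∸ h ]             ≡⟨ cong (λ m → toℕ [ m ]) (m+n∸n≡m h h) ⟩
    toℕ [ h ]                     ≡⟨ toℕ-red-< h<n ⟩
    h                             ≡⟨ toℕ-halfZ ⟨
    toℕ (halfZ {p})               ∎)
    where open ≡-Reasoning

  module _ (ℰ : Subset n) where

    ℰ* : List Z
    ℰ* = elements (Estar {p} ℰ)

    ℰbar : List Z
    ℰbar = ℰ* ++ zeroZ {p} ∷ oneZ {p} ∷ halfZ {p} ∷ []

    InEbar⇒∈ℰbar : ∀ {ε} → InEbar {p} ℰ ε → ε ∈ ℰbar
    InEbar⇒∈ℰbar (inj₁ ε∈ℰ*)                = ∈-++⁺ˡ (∈ₛ⇒∈-elements ε∈ℰ*)
    InEbar⇒∈ℰbar (inj₂ (inj₁ refl))         = ∈-++⁺ʳ ℰ* (here refl)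
    InEbar⇒∈ℰbar (inj₂ (inj₂ (inj₁ refl)))  = ∈-++⁺ʳ ℰ* (there (here refl))
    InEbar⇒∈ℰbar (inj₂ (inj₂ (inj₂ refl)))  = ∈-++⁺ʳ ℰ* (there (there (here refl)))

    αObstructions : List Z
    αObstructions = concatMap roots ℰbar

    length-αObstructions : length αObstructions ≡ 4 * (∣ Estar {p} ℰ ∣ + 3)
    length-αObstructions = begin
      length αObstructions            ≡⟨ length-concatMap-const roots (λ _ → refl) ℰbar ⟩
      4 * length ℰbar                 ≡⟨ cong (4 *_) (length-++ ℰ*) ⟩
      4 * (length ℰ* + 3)             ≡⟨ cong (λ e → 4 * (e + 3)) (length-elements (Estar {p} ℰ)) ⟩
      4 * (∣ Estar {p} ℰ ∣ + 3)       ∎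
      where open ≡-Reasoning

    choose-α : 4 * ∣ Estar {p} ℰ ∣ + 8 < h → ∃ λ α → ∀ ε → InEbar {p} ℰ ε → dbl α ∉ ± ε
    choose-α bound =
      let α , α∉ = injection-avoids _≟_ id id αObstructions
                     (subst₂ _<_ (sym length-αObstructions) (sym 1+k≡h+h) (4[e+3]<h+h {∣ Estar {p} ℰ ∣} bound))
      in α , λ ε ε∈ℰbar → ∉roots⇒dbl∉± (λ α∈roots → α∉ (∈-concatMap⁺ roots α∈roots (InEbar⇒∈ℰbar ε∈ℰbar)))

    specialObstructions : Z → List Z
    specialObstructions α = selfInverseObstructions α (zeroZ {p}) ++ obstructions α (oneZ {p})
                            ++ selfInverseObstructions α (halfZ {p})

    length-specialObstructions : ∀ α → length (specialObstructions α) ≡ 8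
    length-specialObstructions α = begin
      length (at0 ++ at1 ++ atHalf)                         ≡⟨ length-++ at0 {at1 ++ atHalf} ⟩
      length at0 + length (at1 ++ atHalf)                   ≡⟨ cong (length at0 +_) (length-++ at1 {atHalf}) ⟩
      length at0 + (length at1 + length atHalf)             ≡⟨ cong₂ _+_ (length-selfInverseObstructions α (zeroZ {p}))
                                                                (cong₂ _+_ (length-obstructions α (oneZ {p}))
                                                                           (length-selfInverseObstructions α (halfZ {p}))) ⟩
      8                                                     ∎
      where
      open ≡-Reasoning
      at0 at1 atHalf : List Z
      at0    = selfInverseObstructions α (zeroZ {p})
      at1    = obstructions α (oneZ {p})
      atHalf = selfInverseObstructions α (halfZ {p})

    βObstructions : Z → List Z
    βObstructions α = concatMap (obstructions α) ℰ* ++ specialObstructions α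

    length-βObstructions : ∀ α → length (βObstructions α) ≡ 4 * ∣ Estar {p} ℰ ∣ + 8
    length-βObstructions α = begin
      length (βObstructions α)
        ≡⟨ length-++ (concatMap (obstructions α) ℰ*) {specialObstructions α} ⟩
      length (concatMap (obstructions α) ℰ*) + length (specialObstructions α)
        ≡⟨ cong₂ _+_ (length-concatMap-const (obstructions α) (length-obstructions α) ℰ*)
                     (length-specialObstructions α) ⟩
      4 * length ℰ* + 8
        ≡⟨ cong (λ e → 4 * e + 8) (length-elements (Estar {p} ℰ)) ⟩
      4 * ∣ Estar {p} ℰ ∣ + 8
        ∎
      where open ≡-Reasoning

    ∉βObstructions : ∀ {α β ε} → parityᶻ β ≡ not (parityᶻ α) → InEbar {p} ℰ ε →
                     β ∉ βObstructions α → dbl β ∉ ± ε × β ∉ shifts α ε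
    ∉βObstructions {α} {β} {ε} β-opposite (inj₁ ε∈ℰ*) β∉ =
      ∉obstructions {α} {β} ε β-opposite
        (λ β∈ → β∉ (∈-++⁺ˡ (∈-concatMap⁺ (obstructions α) β∈ (∈ₛ⇒∈-elements ε∈ℰ*))))
    ∉βObstructions {α} {β} β-opposite (inj₂ (inj₁ refl)) β∉ =
      ∉selfInverseObstructions {α} {β} neg-zeroZ β-opposite
        (λ β∈ → β∉ (∈-++⁺ʳ (concatMap (obstructions α) ℰ*) (∈-++⁺ˡ β∈)))
    ∉βObstructions {α} {β} β-opposite (inj₂ (inj₂ (inj₁ refl))) β∉ =
      ∉obstructions {α} {β} (oneZ {p}) β-opposite
        (λ β∈ → β∉ (∈-++⁺ʳ (concatMap (obstructions α) ℰ*)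
                     (∈-++⁺ʳ (selfInverseObstructions α (zeroZ {p})) (∈-++⁺ˡ β∈))))
    ∉βObstructions {α} {β} β-opposite (inj₂ (inj₂ (inj₂ refl))) β∉ =
      ∉selfInverseObstructions {α} {β} neg-halfZ β-opposite
        (λ β∈ → β∉ (∈-++⁺ʳ (concatMap (obstructions α) ℰ*)
                     (∈-++⁺ʳ (selfInverseObstructions α (zeroZ {p})) (∈-++⁺ʳ (obstructions α (oneZ {p})) β∈))))

    choose-β : 4 * ∣ Estar {p} ℰ ∣ + 8 < h → ∀ α →
               ∃ λ β → parityᶻ β ≡ not (parityᶻ α) × (∀ ε → InEbar {p} ℰ ε → dbl β ∉ ± ε × β ∉ shifts α ε)
    choose-β bound α =
      let i , β∉ = injection-avoids _≟_ candidate (ofParity-injective 1+k≡h+h b) (βObstructions α)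
                     (subst (_< h) (sym (length-βObstructions α)) bound)
      in candidate i , parity-ofParity 1+k≡h+h b i ,
         λ ε ε∈ℰbar → ∉βObstructions {α} {candidate i} {ε} (parity-ofParity 1+k≡h+h b i) ε∈ℰbar β∉
      where
      b : Bool
      b = not (parityᶻ α)
      candidate : Fin h → Z
      candidate = ofParity 1+k≡h+h b

    solution : 4 * ∣ Estar {p} ℰ ∣ + 8 < h →
      Σ Z λ α → Σ Z λ β →
        ¬ (2 ∣ (toℕ α + toℕ β)) ×
        ((ε : Z) → InEbar {p} ℰ ε →
          (dbl α ≢ ε) × (dbl α ≢ neg ε) × (dbl β ≢ ε) × (dbl β ≢ neg ε) ×
          (β ≢ add α ε) × (β ≢ sub α ε) × (β ≢ add (neg α) ε) × (β ≢ sub (neg α) ε))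
    solution bound =
      let α , 2α∉ = choose-α bound
          β , β-opposite , β-ok = choose-β bound α
      in α , β , α+β-odd {α} {β} β-opposite , λ ε ε∈ℰbar → conditions {α} {β} {ε} (2α∉ ε ε∈ℰbar) (β-ok ε ε∈ℰbar)
      where
      α+β-odd : ∀ {α β} → parityᶻ β ≡ not (parityᶻ α) → ¬ 2 ∣ (toℕ α + toℕ β)
      α+β-odd {α} {β} β-opposite = parity≡true⇒∤ (begin
        parity (toℕ α + toℕ β)          ≡⟨ parity-+ (toℕ α) (toℕ β) ⟩
        parityᶻ α xor parityᶻ β         ≡⟨ cong (parityᶻ α xor_) β-opposite ⟩
        parityᶻ α xor not (parityᶻ α)   ≡⟨ xor-inverseʳ (parityᶻ α) ⟩
        true                            ∎)
        where open ≡-Reasoning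
      conditions : ∀ {α β ε} → dbl α ∉ ± ε → dbl β ∉ ± ε × β ∉ shifts α ε →
        (dbl α ≢ ε) × (dbl α ≢ neg ε) × (dbl β ≢ ε) × (dbl β ≢ neg ε) ×
        (β ≢ add α ε) × (β ≢ sub α ε) × (β ≢ add (neg α) ε) × (β ≢ sub (neg α) ε)
      conditions a (b , s) =
        (λ e → a (here e)) , (λ e → a (there (here e))) , (λ e → b (here e)) , (λ e → b (there (here e))) ,
        (λ e → s (here e)) , (λ e → s (there (here e))) ,
        (λ e → s (there (there (here e)))) , (λ e → s (there (there (there (here e)))))

theorem5p6 : (p : ℕ) → Prime p → ¬ (2 ∣ p) →
    (ℰ : Subset (N p)) →
    4 * ∣ Estar {p} ℰ ∣ + 8 < (p ∸ 1) / 2 →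
    Σ (ZN p) λ α → Σ (ZN p) λ β →
      ¬ (2 ∣ (toℕ α + toℕ β)) ×
      ((ε : ZN p) → InEbar {p} ℰ ε →
        (dblZ {p} α ≢ ε) × (dblZ {p} α ≢ negZ {p} ε) ×
        (dblZ {p} β ≢ ε) × (dblZ {p} β ≢ negZ {p} ε) ×
        (β ≢ addZ {p} α ε) × (β ≢ subZ {p} α ε) ×
        (β ≢ addZ {p} (negZ {p} α) ε) × (β ≢ subZ {p} (negZ {p} α) ε))
theorem5p6 zero          _ _     _ ()
theorem5p6 (suc zero)    _ _     _ ()
theorem5p6 (suc (suc k)) _ p-odd ℰ bound =
  let h , 1+k≡h+h = ∤suc⇒double (suc k) p-odd
  in EvenModulus.solution k h 1+k≡h+h ℰ
       (subst (4 * ∣ Estar {suc (suc k)} ℰ ∣ + 8 <_) (trans (cong (_/ 2) 1+k≡h+h) (double/2 h)) bound)
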